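{- For every formula $A$, if $A\notin\mathbf{L}_{\min}$ then there exists a frame $(W,\leq,R)$ such that $A$ is not valid in $(W,\leq,R)$ and $\mathtt{Card}(W)\leq 2^{\|A\|}$, where $\|A\|$ is the number of symbols in $A$.
   Context: Formulas are built from a countably infinite set of atoms by $A::=p\mid (A\rightarrow A)\mid\top\mid\bot\mid(A\vee A)\mid(A\wedge A)\mid\square A\mid\lozenge A$; $\neg A$ abbreviates $A\rightarrow\bot$. A frame is a triple $(W,\leq,R)$ with $W$ nonempty, $\leq$ a preorder on $W$, $R$ a binary relation on $W$; $\geq$ is the converse of $\leq$, and $s(S\circ T)t$ means there is $u$ with $sSu$ and $uTt$. A valuation assigns to each atom a $\leq$-upward-closed subset of $W$. Satisfaction: $s\models p$ iff $s\in V(p)$; $s\models A\rightarrow B$ iff for all $t\geq s$, $t\models A$ implies $t\models B$; $\top$ always true, $\bot$ never; $\vee,\wedge$ pointwise; $s\models\square A$ iff $t\models A$ for all $t$ with $s(\leq\circ R)t$; $s\models\lozenge A$ iff there is $t$ with $s(\geq\circ R)t$ and $t\models A$. A formula is valid in a frame if true at every state of every model based on it. An intuitionistic modal logic is a set of formulas closed under uniform substitution, containing the axioms of intuitionistic propositional logic, closed under modus ponens, containing (A1) $\square(p\rightarrow q)\rightarrow(\square p\rightarrow\square q)$, (A2) $\square(p\vee q)\rightarrow((\lozenge p\rightarrow\square q)\rightarrow\square q)$, (A3) $\lozenge(p\vee q)\rightarrow\lozenge p\vee\lozenge q$, (A4) $\neg\lozenge\bot$, and closed under (R1) from $p$ infer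 $\square p$, (R2) from $p\rightarrow q$ infer $\lozenge p\rightarrow\lozenge q$, (R3) from $\lozenge p\rightarrow q\vee\square(p\rightarrow r)$ infer $\lozenge p\rightarrow q\vee\lozenge r$. $\mathbf{L}_{\min}$ is the least intuitionistic modal logic. -}

module Defs where

open import Data.Nat using (ℕ; suc; _+_; _≤_; _^_)
open import Data.Fin using (Fin)
open import Data.Product using (Σ; ∃; _×_)
open import Data.Sum using (_⊎_)
open import Data.Empty using (⊥)
open import Data.Unit using (⊤)
open import Relation.Nullary using (¬_)
open import Level using (suc; zero)

infixr 5 _⇒_
data Form : Set where
  atom : ℕ → Form
  _⇒_  : Form → Form → Form
  ⊤'   : Form
  ⊥'   : Form
  _∨'_ : Form → Form → Form
  _∧'_ : Form → Form → Form
  □    : Form → Form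
  ◇    : Form → Form

¬' : Form → Form
¬' A = A ⇒ ⊥'

subst : (ℕ → Form) → Form → Form
subst σ (atom p) = σ p
subst σ (A ⇒ B)  = subst σ A ⇒ subst σ B
subst σ ⊤'       = ⊤'
subst σ ⊥'       = ⊥'
subst σ (A ∨' B) = subst σ A ∨' subst σ B
subst σ (A ∧' B) = subst σ A ∧' subst σ B
subst σ (□ A)    = □ (subst σ A)
subst σ (◇ A)    = ◇ (subst σ A)

-- ‖A‖ : number of symbols (atoms, constants, connectives, modalities;
-- parentheses are not counted)
size : Form → ℕ
size (atom p) = 1
size (A ⇒ B)  = Data.Nat.suc (size A + size B)
size ⊤'       = 1
size ⊥'       = 1
size (A ∨' B) = Data.Nat.suc (size A + size B)
size (A ∧' B) = Data.Nat.suc (size A + size B)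
size (□ A)    = Data.Nat.suc (size A)
size (◇ A)    = Data.Nat.suc (size A)

-- L_min: the least intuitionistic modal logic, as an inductive predicate.
-- IPL is axiomatised by the standard Hilbert schemes; closure under uniform
-- substitution is included explicitly.
data Lmin : Form → Set where
  ipl1  : ∀ A B → Lmin (A ⇒ (B ⇒ A))
  ipl2  : ∀ A B C → Lmin ((A ⇒ (B ⇒ C)) ⇒ ((A ⇒ B) ⇒ (A ⇒ C)))
  ipl3  : ∀ A B → Lmin ((A ∧' B) ⇒ A)
  ipl4  : ∀ A B → Lmin ((A ∧' B) ⇒ B)
  ipl5  : ∀ A B → Lmin (A ⇒ (B ⇒ (A ∧' B)))
  ipl6  : ∀ A B → Lmin (A ⇒ (A ∨' B))
  ipl7  : ∀ A B → Lmin (B ⇒ (A ∨' B))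
  ipl8  : ∀ A B C → Lmin ((A ⇒ C) ⇒ ((B ⇒ C) ⇒ ((A ∨' B) ⇒ C)))
  ipl9  : ∀ A → Lmin (⊥' ⇒ A)
  ipl10 : Lmin ⊤'
  a1    : ∀ A B → Lmin (□ (A ⇒ B) ⇒ (□ A ⇒ □ B))
  a2    : ∀ A B → Lmin (□ (A ∨' B) ⇒ ((◇ A ⇒ □ B) ⇒ □ B))
  a3    : ∀ A B → Lmin (◇ (A ∨' B) ⇒ (◇ A ∨' ◇ B))
  a4    : Lmin (¬' (◇ ⊥'))
  mp    : ∀ {A B} → Lmin (A ⇒ B) → Lmin A → Lmin B
  r1    : ∀ {A} → Lmin A → Lmin (□ A)
  r2    : ∀ {A B} → Lmin (A ⇒ B) → Lmin (◇ A ⇒ ◇ B)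
  r3    : ∀ {A B C} → Lmin (◇ A ⇒ (B ∨' □ (A ⇒ C))) → Lmin (◇ A ⇒ (B ∨' ◇ C))
  sub   : ∀ {A} (σ : ℕ → Form) → Lmin A → Lmin (subst σ A)

-- Frames with a finite carrier Fin n (so Card(W) = n)
record Frame (n : ℕ) : Set₁ where
  field
    _≤w_   : Fin n → Fin n → Set
    ≤-refl  : ∀ s → s ≤w s
    ≤-trans : ∀ {s t u} → s ≤w t → t ≤w u → s ≤w u
    R      : Fin n → Fin n → Set

module _ {n : ℕ} (F : Frame n) where
  open Frame F

  UpClosed : (Fin n → Set) → Set
  UpClosed X = ∀ {s t} → s ≤w t → X s → X t

  Valuation : Set₁
  Valuation = Σ (ℕ → Fin n → Set) λ V → ∀ p → UpClosed (V p)

  sat : (ℕ → Fin n → Set) → Fin n → Form → Set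
  sat V s (atom p) = V p s
  sat V s (A ⇒ B)  = ∀ t → s ≤w t → sat V t A → sat V t B
  sat V s ⊤'       = ⊤
  sat V s ⊥'       = ⊥
  sat V s (A ∨' B) = sat V s A ⊎ sat V s B
  sat V s (A ∧' B) = sat V s A × sat V s B
  sat V s (□ A)    = ∀ t → (∃ λ u → s ≤w u × R u t) → sat V t A
  sat V s (◇ A)    = Σ (Fin n) λ t → (∃ λ u → u ≤w s × R u t) × sat V t A

  Valid : Form → Set₁
  Valid A = (V : Valuation) → ∀ s → sat (Σ.proj₁ V) s A
    where open Data.Product

-- Finite canonical model over L = sf A, which has ‖A‖ entries. Its 2^‖A‖ worlds are the subsets
-- of L, a world s splitting L into the formulas Γ[ s ] it accepts and Δ[ s ] it refutes. The
-- consistent worlds are ordered by inclusion; s R t when t accepts every φ with □φ accepted by s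
-- and refutes every φ with ◇φ refuted by s; s forces p iff Γ[ s ] ⊢ p. At consistent worlds,
-- forcing a formula of L is derivability from Γ[ s ] (truth lemma). Its hard cases build a world
-- by a Lindenbaum extension relative to L: for □ψ on top of an inclusion-maximal world refuting
-- □ψ (using A2), for ◇ψ below an inclusion-minimal world accepting ◇ψ (using R3). A world
-- extending ([] , [ A ]) then refutes A.
-- Constructively, Lindenbaum extensions, extremal worlds and the decidability of forcing exist
-- only under double negation; that suffices because non-validity is itself a negation.

module Submission where

open import Defs
open import Data.Nat using (ℕ; _≤_; _^_)
import Data.Nat as ℕ
import Data.Nat.Properties as ℕ
open import Data.Product using (Σ; _×_)
open import Relation.Nullary using (¬_)

open import Data.Empty using (⊥-elim)
open import Data.Fin using (Fin; zero; suc; finToFun; funToFin)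
open import Data.Fin.Properties using (2↔Bool; finToFun-funToFin; ¬∀⟶∃¬)
open import Data.Fin.Subset
  using (Subset; inside; outside; ∁; ∣_∣)
  renaming (_∈_ to _∈ˢ_; _⊆_ to _⊆ˢ_; _⊂_ to _⊂ˢ_)
open import Data.Fin.Subset.Properties
  using (_∈?_; _⊆?_; ⊆-refl; ⊆-trans; p⊂q⇒∣p∣<∣q∣; x∉p⇒x∈∁p; p⊆q⇒∁p⊇∁q; ∁p⊆∁q⇒p⊇q)
open import Data.List using (List; []; _∷_; _++_; [_]; map; length; lookup; concatMap)
open import Data.List.Properties using (length-++)
open import Data.List.Membership.Propositional using (_∈_; find)
open import Data.List.Membership.Propositional.Properties
  using (∈-++⁺ˡ; ∈-++⁺ʳ; ∈-++⁻; ∈-map⁻; ∈-lookup; ∈-concatMap⁺; ∈-concatMap⁻)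
open import Data.List.Relation.Binary.Subset.Propositional using (_⊆_)
open import Data.List.Relation.Binary.Subset.Propositional.Properties
  using (xs⊆x∷xs; xs⊆xs++ys; xs⊆ys++xs; ⊆-reflexive-↭)
open import Data.List.Relation.Binary.Permutation.Propositional using (↭-sym)
open import Data.List.Relation.Binary.Permutation.Propositional.Properties using (shift)
import Data.List.Relation.Unary.Any as Any
open Any using (here; there; index)
open import Data.List.Relation.Unary.Any.Properties using (lookup-index)
open import Data.Nat.Induction using (<-wellFounded)
open import Data.Product using (∃; _,_; proj₁)
open import Data.Sum using (_⊎_; inj₁; inj₂; [_,_]′)
open import Data.Unit using (tt)
open import Data.Vec as Vec using (tabulate)
open import Data.Vec.Properties using (tabulate-cong; tabulate∘lookup)
open import Function using (_∘_; id; const; case_of_; _on_; Inverse; _⇔_; mk⇔; Equivalence)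
open import Induction.WellFounded using (WellFounded; Acc; acc; module Subrelation)
open import Relation.Binary.Construct.On as On using ()
open import Relation.Binary.PropositionalEquality
  using (_≡_; refl; sym; trans; cong; cong₂; module ≡-Reasoning)
  renaming (subst to transport)
open import Relation.Nullary using (Dec; yes; no; ¬¬-excluded-middle; decidable-stable)
open import Relation.Nullary.Decidable using (_→-dec_)

variable
  k     : ℕ
  Γ Δ Φ : List Form
  φ ψ χ : Form

infix  4 _⊢_ _⊬_
infixl 5 _·_

data _⊢_ (Γ : List Form) : Form → Set where
  hyp  : φ ∈ Γ → Γ ⊢ φ
  lmin : Lmin φ → Γ ⊢ φ
  _·_  : Γ ⊢ φ ⇒ ψ → Γ ⊢ φ → Γ ⊢ ψ

cut : (∀ {ψ} → ψ ∈ Δ → Γ ⊢ ψ) → Δ ⊢ φ → Γ ⊢ φ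
cut Γ⊢Δ (hyp φ∈Δ) = Γ⊢Δ φ∈Δ
cut Γ⊢Δ (lmin ⊢φ) = lmin ⊢φ
cut Γ⊢Δ (d · e)   = cut Γ⊢Δ d · cut Γ⊢Δ e

⊢-weaken : Δ ⊆ Γ → Δ ⊢ φ → Γ ⊢ φ
⊢-weaken Δ⊆Γ = cut (hyp ∘ Δ⊆Γ)

⊢⇒Lmin : [] ⊢ φ → Lmin φ
⊢⇒Lmin (lmin ⊢φ) = ⊢φ
⊢⇒Lmin (d · e)   = mp (⊢⇒Lmin d) (⊢⇒Lmin e)

⇒-refl : ∀ φ → Lmin (φ ⇒ φ)
⇒-refl φ = mp (mp (ipl2 φ (φ ⇒ φ) φ) (ipl1 φ (φ ⇒ φ))) (ipl1 φ φ)

⇒I : φ ∷ Γ ⊢ ψ → Γ ⊢ φ ⇒ ψ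
⇒I {φ} (hyp (here refl))    = lmin (⇒-refl φ)
⇒I {φ} (hyp {ψ} (there ψ∈)) = lmin (ipl1 ψ φ) · hyp ψ∈
⇒I {φ} (lmin {ψ} ⊢ψ)        = lmin (ipl1 ψ φ) · lmin ⊢ψ
⇒I {φ} (_·_ {χ} {ψ} d e)    = lmin (ipl2 φ χ ψ) · ⇒I d · ⇒I e

⇒I-weaken : φ ∷ Γ ⊢ χ → ψ ∷ Γ ⊢ φ ⇒ χ
⇒I-weaken = ⊢-weaken (xs⊆x∷xs _ _) ∘ ⇒I

⊥E : Γ ⊢ ⊥' → Γ ⊢ φ
⊥E = lmin (ipl9 _) ·_

∧I : Γ ⊢ φ → Γ ⊢ ψ → Γ ⊢ φ ∧' ψ
∧I d e = lmin (ipl5 _ _) · d · e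

∧E₁ : Γ ⊢ φ ∧' ψ → Γ ⊢ φ
∧E₁ = lmin (ipl3 _ _) ·_

∧E₂ : Γ ⊢ φ ∧' ψ → Γ ⊢ ψ
∧E₂ = lmin (ipl4 _ _) ·_

∨I₁ : Γ ⊢ φ → Γ ⊢ φ ∨' ψ
∨I₁ = lmin (ipl6 _ _) ·_

∨I₂ : Γ ⊢ ψ → Γ ⊢ φ ∨' ψ
∨I₂ = lmin (ipl7 _ _) ·_

∨E : Γ ⊢ φ ∨' ψ → Γ ⊢ φ ⇒ χ → Γ ⊢ ψ ⇒ χ → Γ ⊢ χ
∨E d e f = lmin (ipl8 _ _ _) · e · f · d

∨-comm : ∀ φ ψ → Lmin (φ ∨' ψ ⇒ ψ ∨' φ)
∨-comm φ ψ = ⊢⇒Lmin (⇒I (∨E (hyp (here refl)) (lmin (ipl7 ψ φ)) (lmin (ipl6 ψ φ))))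

⋁ : List Form → Form
⋁ []       = ⊥'
⋁ (φ ∷ Φ) = φ ∨' ⋁ Φ

⋀ : List Form → Form
⋀ []       = ⊤'
⋀ (φ ∷ Φ) = φ ∧' ⋀ Φ

⋁I : φ ∈ Φ → Γ ⊢ φ → Γ ⊢ ⋁ Φ
⋁I (here refl) d = ∨I₁ d
⋁I (there φ∈Φ) d = ∨I₂ (⋁I φ∈Φ d)

⋁E : Γ ⊢ ⋁ Φ → (∀ {φ} → φ ∈ Φ → Γ ⊢ φ ⇒ χ) → Γ ⊢ χ
⋁E {Φ = []}    d branch = ⊥E d
⋁E {Φ = φ ∷ Φ} d branch =
  ∨E d (branch (here refl)) (⇒I (⋁E (hyp (here refl)) (⊢-weaken (xs⊆x∷xs _ _) ∘ branch ∘ there)))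

⋁-mono : Φ ⊆ Δ → Γ ⊢ ⋁ Φ → Γ ⊢ ⋁ Δ
⋁-mono Φ⊆Δ d = ⋁E d λ φ∈Φ → ⇒I (⋁I (Φ⊆Δ φ∈Φ) (hyp (here refl)))

⋁-singleton : Γ ⊢ ⋁ [ φ ] → Γ ⊢ φ
⋁-singleton d = ⋁E d λ { (here refl) → lmin (⇒-refl _) }

⋀I : (∀ {φ} → φ ∈ Φ → Γ ⊢ φ) → Γ ⊢ ⋀ Φ
⋀I {Φ = []}    _  = lmin ipl10
⋀I {Φ = φ ∷ Φ} ds = ∧I (ds (here refl)) (⋀I (ds ∘ there))

⋀E : Γ ⊢ ⋀ Φ → φ ∈ Φ → Γ ⊢ φ
⋀E d (here refl) = ∧E₁ d
⋀E d (there φ∈Φ) = ⋀E (∧E₂ d) φ∈Φ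

_⊬_ : List Form → List Form → Set
Γ ⊬ Δ = ¬ (Γ ⊢ ⋁ Δ)

⊬-mono : ∀ {Γ′ Δ′} → Γ ⊆ Γ′ → Δ ⊆ Δ′ → Γ′ ⊬ Δ′ → Γ ⊬ Δ
⊬-mono Γ⊆Γ′ Δ⊆Δ′ Γ′⊬Δ′ = Γ′⊬Δ′ ∘ ⋁-mono Δ⊆Δ′ ∘ ⊢-weaken Γ⊆Γ′

⊬-excludes : Γ ⊬ Δ → φ ∈ Δ → ¬ (Γ ⊢ φ)
⊬-excludes Γ⊬Δ φ∈Δ d = Γ⊬Δ (⋁I φ∈Δ d)

⊬-singleton : ¬ (Γ ⊢ φ) → Γ ⊬ [ φ ]
⊬-singleton ⊬φ = ⊬φ ∘ ⋁-singleton

⊬-⋁-pick : ∀ Φ → ⋁ Φ ∷ Γ ⊬ Δ → ¬ ¬ (∃ λ φ → φ ∈ Φ × φ ∷ Γ ⊬ Δ)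
⊬-⋁-pick []      ⊬Δ _ = ⊬Δ (⊥E (hyp (here refl)))
⊬-⋁-pick (φ ∷ Φ) ⊬Δ κ = ¬¬-excluded-middle λ where
  (yes φ⊬Δ) → κ (φ , here refl , φ⊬Δ)
  (no ¬φ⊬Δ) → ⊬-⋁-pick Φ (λ d → ¬φ⊬Δ λ e → ⊬Δ (∨E (hyp (here refl)) (⇒I-weaken e) (⇒I-weaken d)))
                λ (ψ , ψ∈Φ , ψ⊬Δ) → κ (ψ , there ψ∈Φ , ψ⊬Δ)

□-mono : Lmin (φ ⇒ ψ) → Γ ⊢ □ φ → Γ ⊢ □ ψ
□-mono ⊢φ⇒ψ d = lmin (a1 _ _) · lmin (r1 ⊢φ⇒ψ) · d

□-lift : Γ ⊢ φ → map □ Γ ⊢ □ φ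
□-lift {Γ = []}    d = lmin (r1 (⊢⇒Lmin d))
□-lift {Γ = ψ ∷ Γ} d = lmin (a1 ψ _) · ⊢-weaken (xs⊆x∷xs _ _) (□-lift (⇒I d)) · hyp (here refl)

◇-⋁ : ∀ Φ → Γ ⊢ ◇ (⋁ Φ) → Γ ⊢ ⋁ (map ◇ Φ)
◇-⋁ []      d = ⊥E (lmin a4 · d)
◇-⋁ (φ ∷ Φ) d = ∨E (lmin (a3 φ (⋁ Φ)) · d) (lmin (ipl6 _ _)) (⇒I (∨I₂ (◇-⋁ Φ (hyp (here refl)))))

unbox undiamond : Form → List Form
unbox (□ φ) = [ φ ]
unbox _     = []
undiamond (◇ φ) = [ φ ]
undiamond _     = []

□⁻¹ ◇⁻¹ : List Form → List Form
□⁻¹ = concatMap unbox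
◇⁻¹ = concatMap undiamond

∈-□⁻¹⁺ : □ φ ∈ Γ → φ ∈ □⁻¹ Γ
∈-□⁻¹⁺ = ∈-concatMap⁺ unbox ∘ Any.map λ { refl → here refl }

∈-◇⁻¹⁺ : ◇ φ ∈ Γ → φ ∈ ◇⁻¹ Γ
∈-◇⁻¹⁺ = ∈-concatMap⁺ undiamond ∘ Any.map λ { refl → here refl }

map□-□⁻¹ : map □ (□⁻¹ Γ) ⊆ Γ
map□-□⁻¹ ψ∈ with ∈-map⁻ □ ψ∈
... | φ , φ∈ , refl with find (∈-concatMap⁻ unbox φ∈)
...   | □ _ , □φ∈Γ , here refl = □φ∈Γ

map◇-◇⁻¹ : map ◇ (◇⁻¹ Γ) ⊆ Γ
map◇-◇⁻¹ ψ∈ with ∈-map⁻ ◇ ψ∈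
... | φ , φ∈ , refl with find (∈-concatMap⁻ undiamond φ∈)
...   | ◇ _ , ◇φ∈Γ , here refl = ◇φ∈Γ

□-intro : □⁻¹ Γ ⊢ φ → Γ ⊢ □ φ
□-intro = ⊢-weaken map□-□⁻¹ ∘ □-lift

-- Classical reasoning about finite sets, under double negation

¬¬-∀-Fin : {P : Fin k → Set} → (∀ i → ¬ ¬ P i) → ¬ ¬ (∀ i → P i)
¬¬-∀-Fin {0}       _   κ = κ λ ()
¬¬-∀-Fin {ℕ.suc _} ¬¬P κ =
  ¬¬P zero λ P₀ → ¬¬-∀-Fin (¬¬P ∘ suc) λ Pₛ → κ λ { zero → P₀ ; (suc i) → Pₛ i }

⊆∧⊉⇒⊂ : {p q : Subset k} → p ⊆ˢ q → ¬ (q ⊆ˢ p) → p ⊂ˢ q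
⊆∧⊉⇒⊂ {k} {p} {q} p⊆q q⊈p with ¬∀⟶∃¬ k _ (λ x → x ∈? q →-dec x ∈? p) (λ q⊆p → q⊈p (q⊆p _))
... | x , x∈q⇏x∈p =
  p⊆q , x , decidable-stable (x ∈? q) (λ x∉q → x∈q⇏x∈p (⊥-elim ∘ x∉q)) , x∈q⇏x∈p ∘ const

Minimal Maximal : {A : Set} → (A → Subset k) → (A → Set) → A → Set
Minimal h P u = ∀ {w} → h w ⊆ˢ h u → P w → h u ⊆ˢ h w
Maximal h P u = ∀ {w} → h u ⊆ˢ h w → P w → h w ⊆ˢ h u

minimal-below : ∀ {A : Set} {a} (h : A → Subset k) (P : A → Set) →
                P a → ¬ ¬ (∃ λ u → h u ⊆ˢ h a × P u × Minimal h P u)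
minimal-below {a = a} h P = go (wellFounded a)
  where
  wellFounded : WellFounded (_⊂ˢ_ on h)
  wellFounded = Subrelation.wellFounded p⊂q⇒∣p∣<∣q∣ (On.wellFounded (∣_∣ ∘ h) <-wellFounded)

  go : ∀ {a} → Acc (_⊂ˢ_ on h) a → P a → ¬ ¬ (∃ λ u → h u ⊆ˢ h a × P u × Minimal h P u)
  go {a} (acc smaller) Pa none = none (a , ⊆-refl , Pa , λ {w} hw⊆ha Pw →
    decidable-stable (h a ⊆? h w) λ ha⊈hw →
      go (smaller (⊆∧⊉⇒⊂ hw⊆ha ha⊈hw)) Pw λ (u , hu⊆hw , Pu , min) →
        none (u , ⊆-trans hu⊆hw hw⊆ha , Pu , min))

maximal-above : ∀ {A : Set} {a} (h : A → Subset k) (P : A → Set) →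
                P a → ¬ ¬ (∃ λ u → h a ⊆ˢ h u × P u × Maximal h P u)
maximal-above h P Pa κ = minimal-below (∁ ∘ h) P Pa λ (u , ∁hu⊆∁ha , Pu , min) →
  κ (u , ∁p⊆∁q⇒p⊇q ∁hu⊆∁ha , Pu , λ hu⊆hw Pw → ∁p⊆∁q⇒p⊇q (min (p⊆q⇒∁p⊇∁q hu⊆hw) Pw))

-- Lindenbaum extensions relative to finitely many formulas

select : (Fin k → Form) → Subset k → List Form
select f Vec.[]            = []
select f (inside Vec.∷ p)  = f zero ∷ select (f ∘ suc) p
select f (outside Vec.∷ p) = select (f ∘ suc) p

∈-select⁺ : ∀ {f : Fin k → Form} {p i} → i ∈ˢ p → f i ∈ select f p
∈-select⁺ {p = inside Vec.∷ _}  Vec.here      = here refl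
∈-select⁺ {p = inside Vec.∷ _}  (Vec.there i∈) = there (∈-select⁺ i∈)
∈-select⁺ {p = outside Vec.∷ _} (Vec.there i∈) = ∈-select⁺ i∈

∈-select⁻ : ∀ {f : Fin k → Form} {p φ} → φ ∈ select f p → ∃ λ i → i ∈ˢ p × f i ≡ φ
∈-select⁻ {p = inside Vec.∷ _}  (here refl) = zero , Vec.here , refl
∈-select⁻ {f = f} {p = inside Vec.∷ _}  (there φ∈) with ∈-select⁻ {f = f ∘ suc} φ∈
... | i , i∈ , refl = suc i , Vec.there i∈ , refl
∈-select⁻ {f = f} {p = outside Vec.∷ _} φ∈        with ∈-select⁻ {f = f ∘ suc} φ∈
... | i , i∈ , refl = suc i , Vec.there i∈ , refl

select-mono : ∀ {f : Fin k → Form} {p q} → p ⊆ˢ q → select f p ⊆ select f q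
select-mono {f = f} p⊆q φ∈ with ∈-select⁻ {f = f} φ∈
... | i , i∈ , refl = ∈-select⁺ (p⊆q i∈)

select-split : ∀ {f : Fin k → Form} (p : Subset k) i → f i ∈ select f p ⊎ f i ∈ select f (∁ p)
select-split {f = f} p i with i ∈? p
... | yes i∈p = inj₁ (∈-select⁺ {f = f} i∈p)
... | no  i∉p = inj₂ (∈-select⁺ {f = f} (x∉p⇒x∈∁p i∉p))

select-lookup-⊆ : ∀ {L : List Form} p → select (lookup L) p ⊆ L
select-lookup-⊆ {L} p φ∈ with ∈-select⁻ {f = lookup L} {p = p} φ∈
... | i , _ , refl = ∈-lookup i

⊆-shift : ∀ φ Φ (Ψ : List Form) → φ ∷ Φ ++ Ψ ⊆ Φ ++ φ ∷ Ψ
⊆-shift φ Φ Ψ = ⊆-reflexive-↭ (↭-sym (shift φ Φ Ψ))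

lindenbaum : (f : Fin k → Form) → Γ ⊬ Δ →
             ¬ ¬ (∃ λ p → select f p ++ Γ ⊬ select f (∁ p) ++ Δ)
lindenbaum {k = 0}       f Γ⊬Δ κ = κ (Vec.[] , Γ⊬Δ)
lindenbaum {ℕ.suc _} f Γ⊬Δ κ = ¬¬-excluded-middle λ where
  (yes f₀Γ⊬Δ) → lindenbaum (f ∘ suc) f₀Γ⊬Δ λ (p , ⊬) →
    κ (inside Vec.∷ p , ⊬-mono (⊆-shift _ _ _) id ⊬)
  (no ¬f₀Γ⊬Δ) → lindenbaum (f ∘ suc) (λ d → ¬f₀Γ⊬Δ λ e → Γ⊬Δ (∨E d (⇒I e) (lmin (⇒-refl _))))
                  λ (p , ⊬) →
    κ (outside Vec.∷ p , ⊬-mono id (⊆-shift _ _ _) ⊬)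

toSubset : Fin (2 ^ k) → Subset k
toSubset w = tabulate (Inverse.to 2↔Bool ∘ finToFun w)

toSubset-surjective : (p : Subset k) → ∃ λ w → toSubset w ≡ p
toSubset-surjective p = funToFin (Inverse.from 2↔Bool ∘ Vec.lookup p) , (begin
  tabulate (Inverse.to 2↔Bool ∘ finToFun (funToFin (Inverse.from 2↔Bool ∘ Vec.lookup p)))
    ≡⟨ tabulate-cong (cong (Inverse.to 2↔Bool) ∘ finToFun-funToFin _) ⟩
  tabulate (Inverse.to 2↔Bool ∘ Inverse.from 2↔Bool ∘ Vec.lookup p)
    ≡⟨ tabulate-cong (Inverse.strictlyInverseˡ 2↔Bool ∘ Vec.lookup p) ⟩
  tabulate (Vec.lookup p)
    ≡⟨ tabulate∘lookup p ⟩
  p ∎)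
  where open ≡-Reasoning

infix 4 _≺_

data _≺_ : Form → Form → Set where
  ≺⇒ˡ : φ ≺ φ ⇒ ψ
  ≺⇒ʳ : ψ ≺ φ ⇒ ψ
  ≺∨ˡ : φ ≺ φ ∨' ψ
  ≺∨ʳ : ψ ≺ φ ∨' ψ
  ≺∧ˡ : φ ≺ φ ∧' ψ
  ≺∧ʳ : ψ ≺ φ ∧' ψ
  ≺□  : φ ≺ □ φ
  ≺◇  : φ ≺ ◇ φ

SubformulaClosed : List Form → Set
SubformulaClosed L = ∀ {φ ψ} → ψ ≺ φ → φ ∈ L → ψ ∈ L

sf proper : Form → List Form
sf φ = φ ∷ proper φ
proper (atom _) = []
proper (φ ⇒ ψ)  = sf φ ++ sf ψ
proper ⊤'       = []
proper ⊥'       = []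
proper (φ ∨' ψ) = sf φ ++ sf ψ
proper (φ ∧' ψ) = sf φ ++ sf ψ
proper (□ φ)    = sf φ
proper (◇ φ)    = sf φ

length-sf : ∀ φ → length (sf φ) ≡ size φ
length-sf-++ : ∀ φ ψ → length (sf φ ++ sf ψ) ≡ size φ ℕ.+ size ψ
length-sf (atom _) = refl
length-sf (φ ⇒ ψ)  = cong ℕ.suc (length-sf-++ φ ψ)
length-sf ⊤'       = refl
length-sf ⊥'       = refl
length-sf (φ ∨' ψ) = cong ℕ.suc (length-sf-++ φ ψ)
length-sf (φ ∧' ψ) = cong ℕ.suc (length-sf-++ φ ψ)
length-sf (□ φ)    = cong ℕ.suc (length-sf φ)
length-sf (◇ φ)    = cong ℕ.suc (length-sf φ)
length-sf-++ φ ψ = trans (length-++ (sf φ)) (cong₂ ℕ._+_ (length-sf φ) (length-sf ψ))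

sf-⊆ : ∀ {A} → φ ∈ sf A → sf φ ⊆ sf A
proper-⊆ : ∀ A → φ ∈ proper A → sf φ ⊆ proper A
sf-++-⊆ : ∀ A B → φ ∈ sf A ++ sf B → sf φ ⊆ sf A ++ sf B
sf-⊆ (here refl) = id
sf-⊆ {A = A} (there φ∈) = there ∘ proper-⊆ A φ∈
proper-⊆ (A ⇒ B)  = sf-++-⊆ A B
proper-⊆ (A ∨' B) = sf-++-⊆ A B
proper-⊆ (A ∧' B) = sf-++-⊆ A B
proper-⊆ (□ A)    = sf-⊆ {A = A}
proper-⊆ (◇ A)    = sf-⊆ {A = A}
sf-++-⊆ A B φ∈ with ∈-++⁻ (sf A) φ∈
... | inj₁ φ∈A = ∈-++⁺ˡ ∘ sf-⊆ {A = A} φ∈A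
... | inj₂ φ∈B = ∈-++⁺ʳ (sf A) ∘ sf-⊆ {A = B} φ∈B

≺⇒∈proper : ψ ≺ φ → ψ ∈ proper φ
≺⇒∈proper (≺⇒ˡ {ψ = ψ}) = ∈-++⁺ˡ {ys = sf ψ} (here refl)
≺⇒∈proper (≺⇒ʳ {φ = φ}) = ∈-++⁺ʳ (sf φ) (here refl)
≺⇒∈proper (≺∨ˡ {ψ = ψ}) = ∈-++⁺ˡ {ys = sf ψ} (here refl)
≺⇒∈proper (≺∨ʳ {φ = φ}) = ∈-++⁺ʳ (sf φ) (here refl)
≺⇒∈proper (≺∧ˡ {ψ = ψ}) = ∈-++⁺ˡ {ys = sf ψ} (here refl)
≺⇒∈proper (≺∧ʳ {φ = φ}) = ∈-++⁺ʳ (sf φ) (here refl)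
≺⇒∈proper ≺□            = here refl
≺⇒∈proper ≺◇            = here refl

sf-closed : ∀ A → SubformulaClosed (sf A)
sf-closed A ψ≺φ φ∈ = sf-⊆ {A = A} φ∈ (there (≺⇒∈proper ψ≺φ))

-- The canonical model

module Canonical (L : List Form) where

  World : Set
  World = Fin (2 ^ length L)

  variable
    s t : World

  members : World → Subset (length L)
  members = toSubset

  Γ[_] Δ[_] : World → List Form
  Γ[ s ] = select (lookup L) (members s)
  Δ[ s ] = select (lookup L) (∁ (members s))

  Consistent : World → Set
  Consistent s = Γ[ s ] ⊬ Δ[ s ]

  split : φ ∈ L → ∀ s → φ ∈ Γ[ s ] ⊎ φ ∈ Δ[ s ]
  split φ∈L s = transport (λ φ → φ ∈ Γ[ s ] ⊎ φ ∈ Δ[ s ]) (sym (lookup-index φ∈L))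
                          (select-split (members s) (index φ∈L))

  provable⇒∈Γ : Consistent s → φ ∈ L → Γ[ s ] ⊢ φ → φ ∈ Γ[ s ]
  provable⇒∈Γ {s} cs φ∈L d = [ id , (λ φ∈Δ → ⊥-elim (⊬-excludes cs φ∈Δ d)) ]′ (split φ∈L s)

  ⊢? : Consistent s → φ ∈ L → Dec (Γ[ s ] ⊢ φ)
  ⊢? cs φ∈L = [ yes ∘ hyp , no ∘ ⊬-excludes cs ]′ (split φ∈L _)

  ⊢-prime : Consistent s → φ ∈ L → ψ ∈ L → Γ[ s ] ⊢ φ ∨' ψ → Γ[ s ] ⊢ φ ⊎ Γ[ s ] ⊢ ψ
  ⊢-prime {s} cs φ∈L ψ∈L d with split φ∈L s | split ψ∈L s
  ... | inj₁ φ∈Γ | _        = inj₁ (hyp φ∈Γ)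
  ... | inj₂ _   | inj₁ ψ∈Γ = inj₂ (hyp ψ∈Γ)
  ... | inj₂ φ∈Δ | inj₂ ψ∈Δ =
    ⊥-elim (cs (∨E d (⇒I (⋁I φ∈Δ (hyp (here refl)))) (⇒I (⋁I ψ∈Δ (hyp (here refl))))))

  ⊬⇒⊆ : Γ[ s ] ⊬ Δ[ t ] → members s ⊆ˢ members t
  ⊬⇒⊆ {s} {t} s⊬t {i} i∈s = decidable-stable (i ∈? members t) λ i∉t →
    ⊬-excludes s⊬t (∈-select⁺ {p = ∁ (members t)} (x∉p⇒x∈∁p i∉t))
                   (hyp (∈-select⁺ {p = members s} i∈s))

  -- Asking for consistency only along ≼ keeps it a preorder on all worlds, while the truth
  -- lemma, which starts at a consistent world, never reaches an inconsistent one.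
  _≼_ _⟶_ : World → World → Set
  s ≼ t = members s ⊆ˢ members t × (Consistent s → Consistent t)
  s ⟶ t = Consistent t × (∀ {φ} → □ φ ∈ Γ[ s ] → Γ[ t ] ⊢ φ)
                       × (∀ {φ} → ◇ φ ∈ Δ[ s ] → ¬ (Γ[ t ] ⊢ φ))

  canonical : Frame (2 ^ length L)
  canonical = record
    { _≤w_    = _≼_
    ; ≤-refl  = λ _ → ⊆-refl , id
    ; ≤-trans = λ (s⊆t , cs⇒ct) (t⊆u , ct⇒cu) → ⊆-trans s⊆t t⊆u , ct⇒cu ∘ cs⇒ct
    ; R       = _⟶_
    }

  valuation : Valuation canonical
  valuation = (λ p s → Γ[ s ] ⊢ atom p) , λ p (s⊆t , _) → ⊢-weaken (select-mono s⊆t)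

  infix 4 _⊩_
  _⊩_ : World → Form → Set
  s ⊩ φ = sat canonical (proj₁ valuation) s φ

  ⊩-decidable : ¬ ¬ (∀ {φ} → φ ∈ L → ∀ s → Dec (s ⊩ φ))
  ⊩-decidable κ =
    ¬¬-∀-Fin {P = λ i → ∀ s → Dec (s ⊩ lookup L i)} (λ _ → ¬¬-∀-Fin λ _ → ¬¬-excluded-middle) λ dec →
    κ λ φ∈L s → transport (λ φ → Dec (s ⊩ φ)) (sym (lookup-index φ∈L)) (dec (index φ∈L) s)

  record Extension (Γ Δ : List Form) : Set where
    field
      world      : World
      consistent : Consistent world
      compatible : Γ ⊬ Δ[ world ]
      avoids     : ∀ {φ} → φ ∈ Δ → ¬ (Γ[ world ] ⊢ φ)

    keeps : ∀ {φ} → φ ∈ Γ → φ ∈ L → Γ[ world ] ⊢ φ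
    keeps φ∈Γ φ∈L =
      [ hyp , (λ φ∈Δ → ⊥-elim (⊬-excludes compatible φ∈Δ (hyp φ∈Γ))) ]′ (split φ∈L world)

    above : ∀ {s} → Γ[ s ] ⊆ Γ → s ≼ world
    above Γs⊆Γ = ⊬⇒⊆ (⊬-mono Γs⊆Γ id compatible) , const consistent

  open Extension public

  extension-at : ∀ s → Γ[ s ] ++ Γ ⊬ Δ[ s ] ++ Δ → Extension Γ Δ
  extension-at s ⊬ = record
    { world      = s
    ; consistent = ⊬-mono (xs⊆xs++ys _ _) (xs⊆xs++ys _ _) ⊬
    ; compatible = ⊬-mono (xs⊆ys++xs _ _) (xs⊆xs++ys _ _) ⊬
    ; avoids     = λ φ∈Δ d → ⊬ (⋁I (∈-++⁺ʳ _ φ∈Δ) (⊢-weaken (xs⊆xs++ys _ _) d))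
    }

  extend : Γ ⊬ Δ → ¬ ¬ Extension Γ Δ
  extend Γ⊬Δ κ = lindenbaum (lookup L) Γ⊬Δ λ (p , ⊬) →
    case toSubset-surjective p of λ { (s , refl) → κ (extension-at s ⊬) }

  module TruthLemma (closed : SubformulaClosed L) (⊩? : ∀ {φ} → φ ∈ L → ∀ s → Dec (s ⊩ φ)) where

    open Equivalence

    Truth : Form → Set
    Truth φ = ∀ {s} → Consistent s → s ⊩ φ ⇔ Γ[ s ] ⊢ φ

    ⟶-extension : ∀ {s Γ Δ} → (∀ {φ} → □ φ ∈ Γ[ s ] → φ ∈ Γ) → (∀ {φ} → ◇ φ ∈ Δ[ s ] → φ ∈ Δ) →
                  (e : Extension Γ Δ) → s ⟶ world e
    ⟶-extension {s} boxes diamonds e =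
      consistent e , (λ □φ∈ → keeps e (boxes □φ∈) (closed ≺□ (select-lookup-⊆ (members s) □φ∈))) ,
      avoids e ∘ diamonds

    ∧-truth : Truth φ → Truth ψ → Truth (φ ∧' ψ)
    ∧-truth tφ tψ cs = mk⇔ (λ (s⊩φ , s⊩ψ) → ∧I (to (tφ cs) s⊩φ) (to (tψ cs) s⊩ψ))
                             (λ d → from (tφ cs) (∧E₁ d) , from (tψ cs) (∧E₂ d))

    ∨-truth : φ ∨' ψ ∈ L → Truth φ → Truth ψ → Truth (φ ∨' ψ)
    ∨-truth ∈L tφ tψ cs = mk⇔ [ ∨I₁ ∘ to (tφ cs) , ∨I₂ ∘ to (tψ cs) ]′
      ([ inj₁ ∘ from (tφ cs) , inj₂ ∘ from (tψ cs) ]′ ∘ ⊢-prime cs (closed ≺∨ˡ ∈L) (closed ≺∨ʳ ∈L))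

    ⇒-truth : φ ⇒ ψ ∈ L → Truth φ → Truth ψ → Truth (φ ⇒ ψ)
    ⇒-truth {φ} {ψ} ∈L tφ tψ {s} cs = mk⇔ ⊩⇒⊢ ⊢⇒⊩
      where
      ⊢⇒⊩ : Γ[ s ] ⊢ φ ⇒ ψ → s ⊩ φ ⇒ ψ
      ⊢⇒⊩ d t (s⊆t , cs⇒ct) t⊩φ =
        from (tψ (cs⇒ct cs)) (⊢-weaken (select-mono s⊆t) d · to (tφ (cs⇒ct cs)) t⊩φ)

      ⊩⇒⊢ : s ⊩ φ ⇒ ψ → Γ[ s ] ⊢ φ ⇒ ψ
      ⊩⇒⊢ s⊩ = decidable-stable (⊢? cs ∈L) λ s⊬φ⇒ψ →
        extend (⊬-singleton {Γ = φ ∷ Γ[ s ]} (s⊬φ⇒ψ ∘ ⇒I)) λ e →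
          let t⊩φ = from (tφ (consistent e)) (keeps e (here refl) (closed ≺⇒ˡ ∈L))
          in avoids e (here refl)
               (to (tψ (consistent e)) (s⊩ (world e) (above e (xs⊆x∷xs _ _)) t⊩φ))

    -- Were ψ ∨ ⋁ D derivable from □⁻¹ Γ[ u ], where D = ◇⁻¹ Δ[ u ], A2 would derive □ψ from Γ[ u ]
    -- together with ◇δ for some δ ∈ D; extending Γ[ u ] with that ◇δ gives a world above u still
    -- refuting □ψ, hence equal to u by maximality, yet ◇δ ∈ Δ[ u ].
    □-successor : □ ψ ∈ L → ∀ u → Consistent u → ¬ (Γ[ u ] ⊢ □ ψ) →
                  Maximal members (λ t → Consistent t × ¬ (Γ[ t ] ⊢ □ ψ)) u →
                  □⁻¹ Γ[ u ] ⊬ ψ ∷ ◇⁻¹ Δ[ u ]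
    □-successor {ψ} ∈L u cu u⊬□ψ max d =
      ⊬-⋁-pick (map ◇ D) ◇D⊬□ψ λ (χ , χ∈ , χ⊬□ψ) →
      extend χ⊬□ψ λ e →
        let t⊆u = max (proj₁ (above e (xs⊆x∷xs _ _))) (consistent e , avoids e (here refl))
            χ∈Δ = map◇-◇⁻¹ χ∈
        in ⊬-excludes cu χ∈Δ (⊢-weaken (select-mono t⊆u)
             (keeps e (here refl) (select-lookup-⊆ (∁ (members u)) χ∈Δ)))
      where
      D = ◇⁻¹ Δ[ u ]
      ◇D⊬□ψ : ⋁ (map ◇ D) ∷ Γ[ u ] ⊬ [ □ ψ ]
      ◇D⊬□ψ e = u⊬□ψ (lmin (a2 (⋁ D) ψ) · □-mono (∨-comm ψ (⋁ D)) (□-intro d)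
                       · ⇒I (⋁-singleton (⇒I-weaken e · ◇-⋁ D (hyp (here refl)))))

    □-truth : □ ψ ∈ L → Truth ψ → Truth (□ ψ)
    □-truth {ψ} ∈L tψ {s} cs = mk⇔ ⊩⇒⊢ ⊢⇒⊩
      where
      ⊢⇒⊩ : Γ[ s ] ⊢ □ ψ → s ⊩ □ ψ
      ⊢⇒⊩ d t (u , (s⊆u , cs⇒cu) , (ct , boxes , _)) =
        from (tψ ct) (boxes (provable⇒∈Γ (cs⇒cu cs) ∈L (⊢-weaken (select-mono s⊆u) d)))

      ⊩⇒⊢ : s ⊩ □ ψ → Γ[ s ] ⊢ □ ψ
      ⊩⇒⊢ s⊩ = decidable-stable (⊢? cs ∈L) λ s⊬□ψ →
        maximal-above members (λ t → Consistent t × ¬ (Γ[ t ] ⊢ □ ψ)) (cs , s⊬□ψ)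
          λ (u , s⊆u , (cu , u⊬□ψ) , max) →
        extend (□-successor ∈L u cu u⊬□ψ max) λ e →
          avoids e (here refl) (to (tψ (consistent e))
            (s⊩ (world e) (u , (s⊆u , const cu) , ⟶-extension ∈-□⁻¹⁺ (there ∘ ∈-◇⁻¹⁺) e)))

    -- By minimality of u, ◇ψ derives ⋁ Δ[ u ] or ⋀ Γ[ u ]; turning a derivation of ⋁ D from
    -- ψ ∷ □⁻¹ Γ[ u ] into □(ψ ⇒ ⋁ D), R3 then makes Γ[ u ] derive ⋁ Δ[ u ] ∨ ◇ ⋁ D, which
    -- contradicts the consistency of u.
    ◇-successor : ◇ ψ ∈ L → ∀ u → Consistent u → Γ[ u ] ⊢ ◇ ψ →
                  Minimal members (λ t → Consistent t × Γ[ t ] ⊢ ◇ ψ) u →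
                  ψ ∷ □⁻¹ Γ[ u ] ⊬ ◇⁻¹ Δ[ u ]
    ◇-successor {ψ} ∈L u cu u⊢◇ψ min d = ◇ψ-dichotomy λ q →
      cu (∨E (lmin (r3 (premise q)) · u⊢◇ψ) (lmin (⇒-refl _))
             (⇒I (⋁-mono map◇-◇⁻¹ (◇-⋁ D (hyp (here refl))))))
      where
      D = ◇⁻¹ Δ[ u ]

      ◇ψ-dichotomy : ¬ ¬ ([ ◇ ψ ] ⊢ ⋁ (⋁ Δ[ u ] ∷ ⋀ Γ[ u ] ∷ []))
      ◇ψ-dichotomy ◇ψ⊬ = extend ◇ψ⊬ λ e →
        let t⊆u = ⊬⇒⊆ (avoids e (here refl))
            u⊆t = min t⊆u (consistent e , keeps e (here refl) ∈L)
        in avoids e (there (here refl)) (⋀I (hyp ∘ select-mono u⊆t))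

      premise : [ ◇ ψ ] ⊢ ⋁ (⋁ Δ[ u ] ∷ ⋀ Γ[ u ] ∷ []) → Lmin (◇ ψ ⇒ ⋁ Δ[ u ] ∨' □ (ψ ⇒ ⋁ D))
      premise q = ⊢⇒Lmin (⇒I (⋁E q λ where
        (here refl)         → lmin (ipl6 _ _)
        (there (here refl)) → ⇒I (∨I₂ (cut (⋀E (hyp (here refl))) (□-intro (⇒I d))))))

    ◇-truth : ◇ ψ ∈ L → Truth ψ → Truth (◇ ψ)
    ◇-truth {ψ} ∈L tψ {s} cs = mk⇔ ⊩⇒⊢ ⊢⇒⊩
      where
      ⊩⇒⊢ : s ⊩ ◇ ψ → Γ[ s ] ⊢ ◇ ψ
      ⊩⇒⊢ (t , (u , (u⊆s , _) , (ct , _ , diamonds)) , t⊩ψ) =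
        ⊢-weaken (select-mono u⊆s)
          ([ hyp , (λ ◇ψ∈Δ → ⊥-elim (diamonds ◇ψ∈Δ (to (tψ ct) t⊩ψ))) ]′ (split ∈L u))

      ⊢⇒⊩ : Γ[ s ] ⊢ ◇ ψ → s ⊩ ◇ ψ
      ⊢⇒⊩ d = decidable-stable (⊩? ∈L s) λ s⊮◇ψ →
        minimal-below members (λ t → Consistent t × Γ[ t ] ⊢ ◇ ψ) (cs , d)
          λ (u , u⊆s , (cu , u⊢◇ψ) , min) →
        extend (◇-successor ∈L u cu u⊢◇ψ min) λ e →
          s⊮◇ψ (world e , (u , (u⊆s , const cs) , ⟶-extension (there ∘ ∈-□⁻¹⁺) ∈-◇⁻¹⁺ e) ,
                from (tψ (consistent e)) (keeps e (here refl) (closed ≺◇ ∈L)))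

    truth : ∀ φ → φ ∈ L → Truth φ
    truth (atom p) _  _  = mk⇔ id id
    truth (φ ⇒ ψ)  ∈L    = ⇒-truth ∈L (truth φ (closed ≺⇒ˡ ∈L)) (truth ψ (closed ≺⇒ʳ ∈L))
    truth ⊤'       _  _  = mk⇔ (λ _ → lmin ipl10) (λ _ → tt)
    truth ⊥'       _  cs = mk⇔ ⊥-elim (cs ∘ ⊥E)
    truth (φ ∨' ψ) ∈L    = ∨-truth ∈L (truth φ (closed ≺∨ˡ ∈L)) (truth ψ (closed ≺∨ʳ ∈L))
    truth (φ ∧' ψ) ∈L    = ∧-truth (truth φ (closed ≺∧ˡ ∈L)) (truth ψ (closed ≺∧ʳ ∈L))
    truth (□ ψ)    ∈L    = □-truth ∈L (truth ψ (closed ≺□ ∈L))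
    truth (◇ ψ)    ∈L    = ◇-truth ∈L (truth ψ (closed ≺◇ ∈L))

mainTheorem4 : (A : Form) → ¬ Lmin A →
    Σ ℕ λ n → Σ (Frame n) λ F → (¬ Valid F A) × (n ≤ 2 ^ size A)
mainTheorem4 A A∉Lmin =
  2 ^ length (sf A) , canonical , refuted , ℕ.≤-reflexive (cong (2 ^_) (length-sf A))
  where
  open Canonical (sf A)

  refuted : ¬ Valid canonical A
  refuted valid = ⊩-decidable λ ⊩? →
    extend (⊬-singleton (A∉Lmin ∘ ⊢⇒Lmin)) λ e →
      let open TruthLemma (sf-closed A) ⊩?
      in avoids e (here refl)
           (Equivalence.to (truth A (here refl) (consistent e)) (valid valuation (world e)))
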